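{- Let $G=\mathrm{Aut}(AQ_4)$, and let $\mathcal{K}=\{\mathcal{C}_1,\mathcal{C}_2,\mathcal{C}_3,\mathcal{C}_4\}$ and $\mathcal{K}'=\{\mathcal{C}_5,\mathcal{C}_6,\mathcal{C}_7,\mathcal{C}_8\}$ with the cliques listed below. Then $\mathcal{K}$ (and hence $\mathcal{K}'$) is a block of the action of $G$ on $\{\mathcal{C}_1,\dots,\mathcal{C}_8\}$.
   Context: $AQ_4$ is the graph with vertex set $\mathbb{Z}_2^4$ (vectors written as bit strings) in which $x,y$ are adjacent iff $x+y\in S$, where $S=\{1000,0100,0010,0001,0011,0111,1111\}$. Define the 4-cliques $\mathcal{C}_1=\{0000,0010,0001,0011\}$, $\mathcal{C}_2=\{1000,1010,1001,1011\}$, $\mathcal{C}_3=\{0100,0110,0101,0111\}$, $\mathcal{C}_4=\{1100,1110,1101,1111\}$, $\mathcal{C}_5=\{0000,1000,0111,1111\}$, $\mathcal{C}_6=\{0001,1001,0110,1110\}$, $\mathcal{C}_7=\{0011,1011,0100,1100\}$, $\mathcal{C}_8=\{0010,1010,0101,1101\}$. The set $\{\mathcal{C}_1,\dots,\mathcal{C}_8\}$ is invariant under $\mathrm{Aut}(AQ_4)$, so $G$ acts on it. For a group $G$ acting on a set $\Omega$, a block is a subset $\Delta\subseteq\Omega$ such that for every $g\in G$ either $\Delta^g=\Delta$ or $\Delta^g\cap\Delta=\emptyset$. -}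

module Defs where

open import Data.Bool using (Bool; true; false; _xor_)
open import Data.Vec using (Vec; []; _∷_; zipWith)
open import Data.List using (List; []; _∷_)
open import Data.List.Membership.Propositional using (_∈_)
open import Data.Fin using (Fin; toℕ)
open import Data.Nat using (_<_; _≥_)
open import Data.Product using (Σ; ∃; _×_; _,_)
open import Data.Sum using (_⊎_)
open import Relation.Binary.PropositionalEquality using (_≡_)
open import Relation.Nullary using (¬_)

-- Vertices of AQ_4: Z_2^4 as 4-bit vectors, bit strings read left to right.
V : Set
V = Vec Bool 4

_⊕_ : V → V → V
_⊕_ = zipWith _xor_

bits : Bool → Bool → Bool → Bool → V
bits a b c d = a ∷ b ∷ c ∷ d ∷ []

private
  O I : Bool
  O = false
  I = true

S : List V
S = bits I O O O ∷ bits O I O O ∷ bits O O I O ∷ bits O O O I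
  ∷ bits O O I I ∷ bits O I I I ∷ bits I I I I ∷ []

Adj : V → V → Set
Adj x y = (x ⊕ y) ∈ S

record Aut : Set where
  field
    to       : V → V
    from     : V → V
    to-from  : ∀ v → to (from v) ≡ v
    from-to  : ∀ v → from (to v) ≡ v
    preserve : ∀ x y → (Adj x y → Adj (to x) (to y)) × (Adj (to x) (to y) → Adj x y)
open Aut public

-- The eight 4-cliques C_1 … C_8 (index i : Fin 8 stands for C_{i+1}).
C : Fin 8 → List V
C Fin.zero = bits O O O O ∷ bits O O I O ∷ bits O O O I ∷ bits O O I I ∷ []
C (Fin.suc Fin.zero) = bits I O O O ∷ bits I O I O ∷ bits I O O I ∷ bits I O I I ∷ []
C (Fin.suc (Fin.suc Fin.zero)) = bits O I O O ∷ bits O I I O ∷ bits O I O I ∷ bits O I I I ∷ []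
C (Fin.suc (Fin.suc (Fin.suc Fin.zero))) = bits I I O O ∷ bits I I I O ∷ bits I I O I ∷ bits I I I I ∷ []
C (Fin.suc (Fin.suc (Fin.suc (Fin.suc Fin.zero)))) = bits O O O O ∷ bits I O O O ∷ bits O I I I ∷ bits I I I I ∷ []
C (Fin.suc (Fin.suc (Fin.suc (Fin.suc (Fin.suc Fin.zero))))) = bits O O O I ∷ bits I O O I ∷ bits O I I O ∷ bits I I I O ∷ []
C (Fin.suc (Fin.suc (Fin.suc (Fin.suc (Fin.suc (Fin.suc Fin.zero)))))) = bits O O I I ∷ bits I O I I ∷ bits O I O O ∷ bits I I O O ∷ []
C (Fin.suc (Fin.suc (Fin.suc (Fin.suc (Fin.suc (Fin.suc (Fin.suc Fin.zero))))))) = bits O O I O ∷ bits I O I O ∷ bits O I O I ∷ bits I I O I ∷ []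

_∈Img_[_] : V → Aut → Fin 8 → Set
v ∈Img g [ i ] = ∃ λ u → u ∈ C i × to g u ≡ v

_[_]≈_ : Aut → Fin 8 → Fin 8 → Set
g [ i ]≈ j = ∀ v → (v ∈Img g [ i ] → v ∈ C j) × (v ∈ C j → v ∈Img g [ i ])

𝒦 : Fin 8 → Set
𝒦 i = toℕ i < 4

𝒦' : Fin 8 → Set
𝒦' i = toℕ i ≥ 4

-- Δ is a block for the action of Aut(AQ_4) on Ω:
-- for every g, either Δ^g = Δ or Δ^g ∩ Δ = ∅, where
-- Δ^g = { C_i^g : C_i ∈ Δ } (sets of cliques compared extensionally).
IsBlock : (Fin 8 → Set) → Set
IsBlock Δ = (g : Aut) →
    ( ((i : Fin 8) → Δ i → Σ (Fin 8) λ j → Δ j × g [ i ]≈ j)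
    × ((j : Fin 8) → Δ j → Σ (Fin 8) λ i → Δ i × g [ i ]≈ j) )
  ⊎ ((i j : Fin 8) → Δ i → Δ j → ¬ (g [ i ]≈ j))

module Submission where

-- The 4-cliques of AQ₄ are the twelve cosets of three subgroups of order
-- four of Z₂⁴: H₁ = ⟨0010,0001⟩ (C₁…C₄), H₂ = ⟨1000,0111⟩ (C₅…C₈) and
-- H₃ = ⟨0011,0100⟩ (D₁…D₄); this is checked for the cliques through 0000 and
-- transported by translations, which are automorphisms of a Cayley graph.
-- As H₁ ∩ H₂ = 0 while H₃ meets H₁ and H₂ in two elements, the Cᵢ are the
-- 4-cliques meeting another 4-clique in exactly one vertex.  An automorphism
-- g is a bijection preserving 4-cliques, so it preserves this property and
-- disjointness, and induces σ with Cᵢ^g = C_{σ i}.  The families of four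
-- pairwise disjoint Cᵢ are exactly 𝒦 and 𝒦', so σ(𝒦) is 𝒦 or 𝒦': a block.

open import Defs
open import Data.Bool using (Bool; true; false; _xor_)
open import Data.Bool.Properties using (xor-assoc; xor-same; xor-identityʳ; not-involutive)
  renaming (_≟_ to _≟B_)
open import Data.Fin using (Fin; toℕ; #_; splitAt)
import Data.Fin.Properties as Fin
open import Data.List using (List; []; _∷_; map; length)
open import Data.List.Properties using (length-map)
open import Data.List.Relation.Unary.All as All using (All; []; _∷_)
open import Data.List.Relation.Unary.Any using (Any; any?)
import Data.List.Relation.Unary.AllPairs as AllPairs
open AllPairs using (AllPairs; []; _∷_)
import Data.List.Relation.Unary.AllPairs.Properties as AllPairs
open import Data.List.Relation.Binary.Subset.Propositional using (_⊆_)
open import Data.List.Relation.Binary.Subset.Propositional.Properties using (⊆-trans)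
  renaming (map⁺ to ⊆-map⁺)
open import Data.List.Relation.Binary.Disjoint.Propositional using (Disjoint)
open import Data.List.Membership.Propositional using (_∈_; find; lose)
open import Data.List.Membership.Propositional.Properties using (∈-map⁺; ∈-map⁻)
open import Data.Nat using (zero; suc; _<?_; _≤?_) renaming (_≟_ to _≟ℕ_)
open import Data.Nat.Properties using (≤⇒≯; <⇒≱)
open import Data.Product using (Σ; ∃; _×_; _,_; proj₁; proj₂)
open import Data.Sum using (_⊎_; inj₁; inj₂; [_,_]′; swap)
open import Data.Vec using (Vec; []; _∷_; zipWith; replicate)
import Data.Vec as Vec
import Data.Vec.Properties as Vec
import Data.Vec.Relation.Unary.All as VecAll
import Data.Vec.Relation.Unary.Any as VecAny
import Data.Vec.Relation.Unary.Any.Properties as VecAny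
import Data.Vec.Relation.Unary.AllPairs as VecAllPairs
import Data.Vec.Relation.Unary.AllPairs.Properties as VecAllPairs
import Data.Vec.Membership.Propositional as VecMembership
import Data.Vec.Membership.Propositional.Properties as VecMembership
open import Data.Vec.Membership.DecPropositional (Fin._≟_ {8}) using () renaming (_∈?_ to _∈ᶠ?_)
open import Function using (_∘′_)
open import Function.Definitions using (Injective)
open import Relation.Binary.Definitions using (DecidableEquality)
open import Relation.Binary.PropositionalEquality
open import Relation.Nullary using (¬_; Dec)
open import Relation.Nullary.Decidable using (map′; _×-dec_; _⊎-dec_; _→-dec_; toWitness)
open import Relation.Unary using (Decidable)

module _ {A : Set} where

  _≋_ : List A → List A → Set
  xs ≋ ys = xs ⊆ ys × ys ⊆ xs

  ≋-trans : ∀ {xs ys zs} → xs ≋ ys → ys ≋ zs → xs ≋ zs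
  ≋-trans (xs⊆ys , ys⊆xs) (ys⊆zs , zs⊆ys) = ⊆-trans xs⊆ys ys⊆zs , ⊆-trans zs⊆ys ys⊆xs

  MeetOnce : List A → List A → Set
  MeetOnce xs ys = ∃ λ u → (u ∈ xs × u ∈ ys) × (∀ {w} → w ∈ xs → w ∈ ys → w ≡ u)

  disjoint-resp-≋ : ∀ {xs xs' ys ys'} → xs ≋ xs' → ys ≋ ys' → Disjoint xs ys → Disjoint xs' ys'
  disjoint-resp-≋ (_ , xs'⊆xs) (_ , ys'⊆ys) xs#ys (v∈xs' , v∈ys') = xs#ys (xs'⊆xs v∈xs' , ys'⊆ys v∈ys')

  meetOnce-resp-≋ : ∀ {xs xs' ys ys'} → xs ≋ xs' → ys ≋ ys' → MeetOnce xs ys → MeetOnce xs' ys'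
  meetOnce-resp-≋ (xs⊆xs' , xs'⊆xs) (ys⊆ys' , ys'⊆ys) (u , (u∈xs , u∈ys) , unique) =
    u , (xs⊆xs' u∈xs , ys⊆ys' u∈ys) , λ w∈xs' w∈ys' → unique (xs'⊆xs w∈xs') (ys'⊆ys w∈ys')

≋-map : ∀ {A B : Set} (f : A → B) {xs ys : List A} → xs ≋ ys → map f xs ≋ map f ys
≋-map f (xs⊆ys , ys⊆xs) = ⊆-map⁺ f xs⊆ys , ⊆-map⁺ f ys⊆xs

module _ {A : Set} (_≟_ : DecidableEquality A) where

  open import Data.List.Membership.DecPropositional _≟_ using (_∈?_)

  meetOnce? : ∀ xs ys → Dec (MeetOnce xs ys)
  meetOnce? xs ys =
    map′ fromSearch toSearch (any? (λ u → (u ∈? ys) ×-dec All.all? (λ w → (w ∈? ys) →-dec (w ≟ u)) xs) xs)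
    where
    Search : Set
    Search = Any (λ u → u ∈ ys × All (λ w → w ∈ ys → w ≡ u) xs) xs

    fromSearch : Search → MeetOnce xs ys
    fromSearch found with find found
    ... | u , u∈xs , u∈ys , unique = u , (u∈xs , u∈ys) , λ w∈xs → All.lookup unique w∈xs

    toSearch : MeetOnce xs ys → Search
    toSearch (u , (u∈xs , u∈ys) , unique) = lose u∈xs (u∈ys , All.tabulate unique)

module _ {A B : Set} {f : A → B} (f-injective : Injective _≡_ _≡_ f) where

  common-preimage : ∀ {v xs ys} → v ∈ map f xs → v ∈ map f ys → ∃ λ u → (u ∈ xs × u ∈ ys) × v ≡ f u
  common-preimage v∈fxs v∈fys with ∈-map⁻ f v∈fxs | ∈-map⁻ f v∈fys
  ... | x , x∈xs , v≡fx | y , y∈ys , v≡fy =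
    x , (x∈xs , subst (_∈ _) (f-injective (trans (sym v≡fy) v≡fx)) y∈ys) , v≡fx

  disjoint-map : ∀ {xs ys} → Disjoint xs ys → Disjoint (map f xs) (map f ys)
  disjoint-map xs#ys (v∈fxs , v∈fys) = xs#ys (proj₁ (proj₂ (common-preimage v∈fxs v∈fys)))

  meetOnce-map : ∀ {xs ys} → MeetOnce xs ys → MeetOnce (map f xs) (map f ys)
  meetOnce-map (u , (u∈xs , u∈ys) , unique) = f u , (∈-map⁺ f u∈xs , ∈-map⁺ f u∈ys) , only-fu
    where
    only-fu : ∀ {w} → w ∈ map f _ → w ∈ map f _ → w ≡ f u
    only-fu w∈fxs w∈fys with common-preimage w∈fxs w∈fys
    ... | x , (x∈xs , x∈ys) , w≡fx = trans w≡fx (cong f (unique x∈xs x∈ys))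

-- Finite types are searchable, and so are vectors over a searchable type;
-- this is what makes the finite facts below checkable by evaluation.
Searchable : Set → Set₁
Searchable A = ∀ {P : A → Set} → Decidable P → Dec (∀ a → P a)

bool-searchable : Searchable Bool
bool-searchable P? = map′ (λ { (pf , pt) false → pf ; (pf , pt) true → pt }) (λ p → p false , p true)
                          (P? false ×-dec P? true)

vec-searchable : ∀ {A} n → Searchable A → Searchable (Vec A n)
vec-searchable zero    _      P? = map′ (λ { p [] → p }) (λ p → p []) (P? [])
vec-searchable (suc n) search P? =
  map′ (λ { p (x ∷ xs) → p x xs }) (λ p x xs → p (x ∷ xs))
       (search λ x → vec-searchable n search λ xs → P? (x ∷ xs))

_≟V_ : DecidableEquality V
_≟V_ = Vec.≡-dec _≟B_

open import Data.List.Membership.DecPropositional _≟V_ using (_∈?_)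
open import Data.List.Relation.Binary.Subset.DecPropositional _≟V_ using (_⊆?_)
open import Data.List.Relation.Binary.Disjoint.DecPropositional _≟V_ using (disjoint?)

_≋?_ : (xs ys : List V) → Dec (xs ≋ ys)
xs ≋? ys = (xs ⊆? ys) ×-dec (ys ⊆? xs)

-- Z₂ⁿ under pointwise xor: every element is its own inverse, so each
-- translation x ↦ a ⊕ x is an involution and preserves differences.
xor-cancelˡ : ∀ x y → x xor (x xor y) ≡ y
xor-cancelˡ x y = trans (sym (xor-assoc x x y)) (cong (_xor y) (xor-same x))

xor-translate : ∀ x y z → (x xor y) xor (x xor z) ≡ y xor z
xor-translate false y     z = refl
xor-translate true  false z = not-involutive z
xor-translate true  true  z = refl

⊕-cancelˡ : ∀ {n} (a b : Vec Bool n) → zipWith _xor_ a (zipWith _xor_ a b) ≡ b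
⊕-cancelˡ []       []       = refl
⊕-cancelˡ (x ∷ a) (y ∷ b) = cong₂ _∷_ (xor-cancelˡ x y) (⊕-cancelˡ a b)

⊕-identityʳ : ∀ {n} (a : Vec Bool n) → zipWith _xor_ a (replicate n false) ≡ a
⊕-identityʳ []      = refl
⊕-identityʳ (x ∷ a) = cong₂ _∷_ (xor-identityʳ x) (⊕-identityʳ a)

⊕-translate : ∀ {n} (a b c : Vec Bool n) →
              zipWith _xor_ (zipWith _xor_ a b) (zipWith _xor_ a c) ≡ zipWith _xor_ b c
⊕-translate []      []      []      = refl
⊕-translate (x ∷ a) (y ∷ b) (z ∷ c) = cong₂ _∷_ (xor-translate x y z) (⊕-translate a b c)

translate-involutive : ∀ a (xs : List V) → map (a ⊕_) (map (a ⊕_) xs) ≡ xs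
translate-involutive a []       = refl
translate-involutive a (x ∷ xs) = cong₂ _∷_ (⊕-cancelˡ a x) (translate-involutive a xs)

zeroV : V
zeroV = replicate 4 false

-- AQ₄ is a Cayley graph, so translations are graph automorphisms.
Adj-translate : ∀ a {b c} → Adj b c → Adj (a ⊕ b) (a ⊕ c)
Adj-translate a {b} {c} = subst (_∈ S) (sym (⊕-translate a b c))

adj? : ∀ x y → Dec (Adj x y)
adj? x y = (x ⊕ y) ∈? S

IsClique : List V → Set
IsClique = AllPairs Adj

FourClique : List V → Set
FourClique xs = IsClique xs × length xs ≡ 4

private
  O I : Bool
  O = false
  I = true

-- The cosets of H₃ = ⟨0011,0100⟩, the 4-cliques other than C₁…C₈.
D : Fin 4 → List V
D Fin.zero                         = bits O O O O ∷ bits O O I I ∷ bits O I O O ∷ bits O I I I ∷ []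
D (Fin.suc Fin.zero)               = bits I O O O ∷ bits I O I I ∷ bits I I O O ∷ bits I I I I ∷ []
D (Fin.suc (Fin.suc Fin.zero))     = bits O O O I ∷ bits O O I O ∷ bits O I O I ∷ bits O I I O ∷ []
D (Fin.suc (Fin.suc (Fin.suc _)))  = bits I O O I ∷ bits I O I O ∷ bits I I O I ∷ bits I I I O ∷ []

Clique : Fin 12 → List V
Clique m = [ C , D ]′ (splitAt 8 m)

opaque
  -- The 4-cliques through 0000 are listed: their other vertices lie in S.
  cliques-through-zero :
    All (λ s₁ → All (λ s₂ → All (λ s₃ →
      IsClique (s₁ ∷ s₂ ∷ s₃ ∷ []) → ∃ λ m → (zeroV ∷ s₁ ∷ s₂ ∷ s₃ ∷ []) ≋ Clique m) S) S) S
  cliques-through-zero = toWitness {a? = All.all? (λ s₁ → All.all? (λ s₂ → All.all? (λ s₃ →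
    AllPairs.allPairs? adj? (s₁ ∷ s₂ ∷ s₃ ∷ []) →-dec Fin.any? (λ m → (zeroV ∷ s₁ ∷ s₂ ∷ s₃ ∷ []) ≋? Clique m)) S) S) S} _

  translate-clique : ∀ a m → ∃ λ m' → map (a ⊕_) (Clique m) ≋ Clique m'
  translate-clique = toWitness {a? = vec-searchable 4 bool-searchable λ a →
    Fin.all? λ m → Fin.any? λ m' → map (a ⊕_) (Clique m) ≋? Clique m'} _

-- Every 4-clique is one of the twelve: translating by one of its vertices a
-- gives a 4-clique through 0000, whose other vertices lie in S.
classify-clique : ∀ {xs} → FourClique xs → ∃ λ m → xs ≋ Clique m
classify-clique {a ∷ b ∷ c ∷ d ∷ []} (((ab ∷ ac ∷ ad ∷ []) ∷ (bc ∷ bd ∷ []) ∷ (cd ∷ []) ∷ [] ∷ []) , _) =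
  proj₁ moved , subst (_≋ Clique (proj₁ moved)) translate-back
                      (≋-trans (≋-map (a ⊕_) (proj₂ translated)) (proj₂ moved))
  where
  translated-clique : IsClique (a ⊕ b ∷ a ⊕ c ∷ a ⊕ d ∷ [])
  translated-clique = (Adj-translate a bc ∷ Adj-translate a bd ∷ []) ∷ (Adj-translate a cd ∷ []) ∷ [] ∷ []

  translated : ∃ λ m → (zeroV ∷ a ⊕ b ∷ a ⊕ c ∷ a ⊕ d ∷ []) ≋ Clique m
  translated = All.lookup (All.lookup (All.lookup cliques-through-zero ab) ac) ad translated-clique

  moved : ∃ λ m' → map (a ⊕_) (Clique (proj₁ translated)) ≋ Clique m'
  moved = translate-clique a (proj₁ translated)

  translate-back : map (a ⊕_) (zeroV ∷ map (a ⊕_) (b ∷ c ∷ d ∷ [])) ≡ a ∷ b ∷ c ∷ d ∷ []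
  translate-back = cong₂ _∷_ (⊕-identityʳ a) (translate-involutive a (b ∷ c ∷ d ∷ []))
classify-clique {[]} (_ , ())
classify-clique {_ ∷ []} (_ , ())
classify-clique {_ ∷ _ ∷ []} (_ , ())
classify-clique {_ ∷ _ ∷ _ ∷ []} (_ , ())
classify-clique {_ ∷ _ ∷ _ ∷ _ ∷ _ ∷ _} (_ , ())

opaque
  C-fourClique : ∀ i → FourClique (C i)
  C-fourClique = toWitness {a? = Fin.all? λ i → AllPairs.allPairs? adj? (C i) ×-dec (length (C i) ≟ℕ 4)} _

  -- Each Cᵢ meets another Cₖ in exactly one vertex (a coset of H₁ and one of H₂).
  C-meets-once : ∀ i → ∃ λ k → MeetOnce (C i) (C k)
  C-meets-once = toWitness {a? = Fin.all? λ i → Fin.any? λ k → meetOnce? _≟V_ (C i) (C k)} _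

  meets-once⇒C : ∀ m m' → MeetOnce (Clique m) (Clique m') → ∃ λ j → Clique m ≋ C j
  meets-once⇒C = toWitness {a? = Fin.all? λ m → Fin.all? λ m' →
    meetOnce? _≟V_ (Clique m) (Clique m') →-dec Fin.any? λ j → Clique m ≋? C j} _

  C-injective : ∀ j j' → C j ⊆ C j' → j ≡ j'
  C-injective = toWitness {a? = Fin.all? λ j → Fin.all? λ j' → (C j ⊆? C j') →-dec (j Fin.≟ j')} _

module _ (g : Aut) where

  to-injective : Injective _≡_ _≡_ (to g)
  to-injective {x} {y} gx≡gy = begin
    x                  ≡⟨ sym (from-to g x) ⟩
    from g (to g x)    ≡⟨ cong (from g) gx≡gy ⟩
    from g (to g y)    ≡⟨ from-to g y ⟩
    y                  ∎
    where open ≡-Reasoning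

  image-fourClique : ∀ {xs} → FourClique xs → FourClique (map (to g) xs)
  image-fourClique {xs} (clique , size) =
    AllPairs.map⁺ (AllPairs.map (λ {x} {y} → proj₁ (preserve g x y)) clique) ,
    trans (length-map (to g) xs) size

  -- The image of Cᵢ is a 4-clique meeting the image of its partner Cₖ in
  -- exactly one vertex, so it is one of C₁…C₈.  Only this specification of
  -- σ is used later, so its construction is kept opaque.
  opaque
    image-of-C : ∀ i → ∃ λ j → map (to g) (C i) ≋ C j
    image-of-C i with C-meets-once i
    ... | k , meet
      with classify-clique (image-fourClique (C-fourClique i)) | classify-clique (image-fourClique (C-fourClique k))
    ... | m , image-i | m' , image-k
      with meets-once⇒C m m' (meetOnce-resp-≋ image-i image-k (meetOnce-map to-injective meet))
    ... | j , clique-j = j , ≋-trans image-i clique-j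

  σ : Fin 8 → Fin 8
  σ i = proj₁ (image-of-C i)

  ≋⇒≈ : ∀ {i j} → map (to g) (C i) ≋ C j → g [ i ]≈ j
  ≋⇒≈ (image⊆ , ⊆image) v =
    (λ { (u , u∈Ci , gu≡v) → image⊆ (subst (_∈ _) gu≡v (∈-map⁺ (to g) u∈Ci)) }) ,
    (λ v∈Cj → let (u , u∈Ci , v≡gu) = ∈-map⁻ (to g) (⊆image v∈Cj) in u , u∈Ci , sym v≡gu)

  ≈⇒⊆ : ∀ {i j} → g [ i ]≈ j → C j ⊆ map (to g) (C i)
  ≈⇒⊆ gi≈j {v} v∈Cj with proj₂ (gi≈j v) v∈Cj
  ... | u , u∈Ci , gu≡v = subst (_∈ _) gu≡v (∈-map⁺ (to g) u∈Ci)

  σ-image : ∀ i → g [ i ]≈ σ i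
  σ-image i = ≋⇒≈ (proj₂ (image-of-C i))

  σ-unique : ∀ {i j} → g [ i ]≈ j → j ≡ σ i
  σ-unique {i} gi≈j = C-injective _ _ (⊆-trans (≈⇒⊆ gi≈j) (proj₁ (proj₂ (image-of-C i))))

  σ-disjoint : ∀ {i k} → Disjoint (C i) (C k) → Disjoint (C (σ i)) (C (σ k))
  σ-disjoint {i} {k} = disjoint-resp-≋ (proj₂ (image-of-C i)) (proj₂ (image-of-C k)) ∘′ disjoint-map to-injective

Family : Set
Family = Vec (Fin 8) 4

PairwiseDisjoint : Family → Set
PairwiseDisjoint = VecAllPairs.AllPairs (λ i j → Disjoint (C i) (C j))

Enumerates : (Fin 8 → Set) → Family → Set
Enumerates Δ q = VecAll.All Δ q × (∀ i → Δ i → i VecMembership.∈ q)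

-- If Δ is listed by a pairwise disjoint family, and every pairwise disjoint
-- family lists Δ or a set Δ' disjoint from Δ, then Δ is a block: the image
-- family σ(q) lists Δ (so Δ^g = Δ) or Δ' (so Δ^g ∩ Δ = ∅).
block : ∀ {Δ Δ' : Fin 8 → Set} → (∀ {i} → Δ' i → ¬ Δ i) →
        (q : Family) → Enumerates Δ q → PairwiseDisjoint q →
        (∀ q' → PairwiseDisjoint q' → Enumerates Δ q' ⊎ Enumerates Δ' q') →
        IsBlock Δ
block {Δ} {Δ'} Δ'∩Δ=∅ q (all-Δ , covers-Δ) q-disjoint families g
  with families (Vec.map (σ g) q) (VecAllPairs.map⁺ (VecAllPairs.map (σ-disjoint g) q-disjoint))
... | inj₁ (all-Δ' , covers-Δ') = inj₁ (forward , backward)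
  where
  forward : ∀ i → Δ i → Σ (Fin 8) λ j → Δ j × g [ i ]≈ j
  forward i Δi = σ g i , VecAll.lookup all-Δ' (VecMembership.∈-map⁺ (σ g) (covers-Δ i Δi)) , σ-image g i

  backward : ∀ j → Δ j → Σ (Fin 8) λ i → Δ i × g [ i ]≈ j
  backward j Δj = i , Δi , subst (g [ i ]≈_) (sym j≡σi) (σ-image g i)
    where
    preimage : VecAny.Any (λ i → j ≡ σ g i) q
    preimage = VecAny.map⁻ (covers-Δ' j Δj)

    i : Fin 8
    i = VecAny.lookup preimage

    Δi×j≡σi : Δ i × j ≡ σ g i
    Δi×j≡σi = VecAll.lookupAny all-Δ preimage

    Δi : Δ i
    Δi = proj₁ Δi×j≡σi

    j≡σi : j ≡ σ g i
    j≡σi = proj₂ Δi×j≡σi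
... | inj₂ (all-Δ'' , _) = inj₂ λ i j Δi Δj gi≈j →
  Δ'∩Δ=∅ (VecAll.lookup all-Δ'' (VecMembership.∈-map⁺ (σ g) (covers-Δ i Δi))) (subst Δ (σ-unique g gi≈j) Δj)

𝒦? : Decidable 𝒦
𝒦? i = toℕ i <? 4

𝒦'? : Decidable 𝒦'
𝒦'? i = 4 ≤? toℕ i

enumerates? : ∀ {Δ} → Decidable Δ → Decidable (Enumerates Δ)
enumerates? Δ? q = VecAll.all? Δ? q ×-dec Fin.all? λ i → Δ? i →-dec i ∈ᶠ? q

pairwiseDisjoint? : Decidable PairwiseDisjoint
pairwiseDisjoint? = VecAllPairs.allPairs? (λ i j → disjoint? (C i) (C j))

𝒦-family 𝒦'-family : Family
𝒦-family  = # 0 ∷ # 1 ∷ # 2 ∷ # 3 ∷ []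
𝒦'-family = # 4 ∷ # 5 ∷ # 6 ∷ # 7 ∷ []

opaque
  -- 𝒦 and 𝒦' are the parallel classes of cosets of H₁ and of H₂.
  𝒦-disjoint-family : Enumerates 𝒦 𝒦-family × PairwiseDisjoint 𝒦-family
  𝒦-disjoint-family = toWitness {a? = enumerates? 𝒦? 𝒦-family ×-dec pairwiseDisjoint? 𝒦-family} _

  𝒦'-disjoint-family : Enumerates 𝒦' 𝒦'-family × PairwiseDisjoint 𝒦'-family
  𝒦'-disjoint-family = toWitness {a? = enumerates? 𝒦'? 𝒦'-family ×-dec pairwiseDisjoint? 𝒦'-family} _

  -- A coset of H₁ meets every coset of H₂, so a pairwise disjoint family
  -- consists of cosets of one subgroup only.
  disjoint-families : ∀ q → PairwiseDisjoint q → Enumerates 𝒦 q ⊎ Enumerates 𝒦' q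
  disjoint-families = toWitness {a? = vec-searchable 4 Fin.all? λ q →
    pairwiseDisjoint? q →-dec (enumerates? 𝒦? q ⊎-dec enumerates? 𝒦'? q)} _

mainTheorem8 : IsBlock 𝒦 × IsBlock 𝒦'
mainTheorem8 =
    block ≤⇒≯ 𝒦-family (proj₁ 𝒦-disjoint-family) (proj₂ 𝒦-disjoint-family)
          disjoint-families
  , block <⇒≱ 𝒦'-family (proj₁ 𝒦'-disjoint-family) (proj₂ 𝒦'-disjoint-family)
          (λ q q-disjoint → swap (disjoint-families q q-disjoint))
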